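{- Let $n\ge1$, $A\in\mathrm{Int}(n)$ and $x=\Gamma(A)=(x_1,\dots,x_n)$. Then $\sum_{i,j}\max\{0,A_{i,j}-1\}=|\{i\in[1,n-1]:x_i=x_{i+1}\}|$.
   Context: $\mathrm{Int}(n)$ is the set of upper triangular square matrices with non-negative integer entries summing to $n$ such that every row and column has a non-zero entry. For such $A$: $\dim(A)$ is the number of rows, $\mathrm{index}(A)$ the smallest $i$ with $A_{i,\dim(A)}>0$, $\mathrm{val}(A)=A_{\mathrm{index}(A),\dim(A)}$. For a sequence $y$, $\mathrm{asc}(y)$ is the number of $i$ with $y_i<y_{i+1}$; $\mathrm{Asc}(n)$ is the set of integer sequences $(x_1,\dots,x_n)$ with $x_1=0$ and $x_i\in[0,1+\mathrm{asc}(x_1,\dots,x_{i-1})]$ for $1<i\le n$. Removal operation $f$ on $A\in\mathrm{Int}(n)$, $n\ge2$: (Rem1) if $\mathrm{val}(A)>1$, or if $\mathrm{val}(A)=1$, $\mathrm{index}(A)<\dim(A)$ and row $\mathrm{index}(A)$ has another positive entry, decrease entry $(\mathrm{index}(A),\dim(A))$ by $1$; (Rem2) if $\mathrm{val}(A)=1$ and $\mathrm{index}(A)=\dim(A)$, delete last row and column; (Rem3) if $\mathrm{val}(A)=1$, $\mathrm{index}(A)<\dim(A)$ and all other entries of row $\mathrm{index}(A)$ are $0$, set $A_{i,\dim(A)}:=A_{i,\mathrm{index}(A)}$ for $1\le i\le\mathrm{index}(A)-1$, then delete row and column $\mathrm{index}(A)$. $\Gamma:\mathrm{Int}(n)\to\mathrm{Asc}(n)$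 (a bijection): $\Gamma((1))=(0)$ and for $n\ge2$, $\Gamma(A)$ is $\Gamma(f(A))$ with $\mathrm{index}(A)-1$ appended. -}

module Defs where

open import Data.Nat using (ℕ; zero; suc; _+_; _∸_; _<_; _≡ᵇ_; _<ᵇ_)
open import Data.Fin using (Fin; zero; suc; toℕ; fromℕ; inject₁; punchIn; _≟_)
import Data.Fin as F
open import Data.Product using (Σ; ∃; _,_; _×_)
open import Data.Maybe using (Maybe; just; nothing)
open import Data.List using (List; []; _∷_; _++_; [_])
open import Data.Bool using (Bool; true; false; if_then_else_)
open import Relation.Nullary using (yes; no)
open import Relation.Binary.PropositionalEquality using (_≡_)

Mat : ℕ → Set
Mat d = Fin d → Fin d → ℕ

DMat : Set
DMat = Σ ℕ Mat

sumFin : ∀ {d} → (Fin d → ℕ) → ℕ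
sumFin {zero}  g = 0
sumFin {suc d} g = g zero + sumFin (λ i → g (suc i))

entrySum : ∀ {d} → Mat d → ℕ
entrySum A = sumFin (λ i → sumFin (λ j → A i j))

record IsInt (n : ℕ) (M : DMat) : Set where
  field
    upper  : ∀ (i j : Fin (Data.Product.proj₁ M)) → j F.< i → Data.Product.proj₂ M i j ≡ 0
    total  : entrySum (Data.Product.proj₂ M) ≡ n
    rowNZ  : ∀ (i : Fin (Data.Product.proj₁ M)) → ∃ λ j → 0 < Data.Product.proj₂ M i j
    colNZ  : ∀ (j : Fin (Data.Product.proj₁ M)) → ∃ λ i → 0 < Data.Product.proj₂ M i j

findFirst : ∀ {d} → (Fin d → ℕ) → Maybe (Fin d)
findFirst {zero}  g = nothing
findFirst {suc d} g with g zero
... | suc _ = just zero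
... | zero with findFirst (λ i → g (suc i))
...   | just k  = just (suc k)
...   | nothing = nothing

-- index(A) - 1, i.e. the 0-based row index of the first positive entry of
-- the last column (0 if there is none, which does not happen on Int(n)).
index0 : DMat → ℕ
index0 (zero , A) = 0
index0 (suc m , A) with findFirst (λ i → A i (fromℕ m))
... | just k  = toℕ k
... | nothing = 0

decAt : ∀ {d} → Mat d → Fin d → Fin d → Mat d
decAt A k l i j with i ≟ k | j ≟ l
... | yes _ | yes _ = A i j ∸ 1
... | _     | _     = A i j

-- Rem3 helper: set A_{i,last} := A_{i,k} for i < k, then delete row/column k.
rem3 : ∀ {m} → Mat (suc m) → Fin (suc m) → Mat m
rem3 {m} A k i j = A' (punchIn k i) (punchIn k j)
  where
  A' : Mat (suc m)
  A' r c with c ≟ fromℕ m | toℕ r <ᵇ toℕ k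
  ... | yes _ | true = A r k
  ... | _     | _    = A r c

removal : DMat → DMat
removal (zero , A) = (zero , A)
removal (suc m , A) with findFirst (λ i → A i (fromℕ m))
... | nothing = (suc m , A)
... | just k with A k (fromℕ m)
...   | zero = (suc m , A)
...   | suc (suc _) = (suc m , decAt A k (fromℕ m))                  -- Rem1, val > 1
...   | suc zero with k ≟ fromℕ m
...     | yes _ = (m , λ i j → A (inject₁ i) (inject₁ j))           -- Rem2
...     | no _ with sumFin (λ j → A k (inject₁ j))
...       | suc _ = (suc m , decAt A k (fromℕ m))                    -- Rem1, other positive entry in row
...       | zero  = (m , rem3 A k)                                  -- Rem3

-- Γ, computed with the size n as recursion parameter:
-- Γ((1)) = (0), and Γ(A) = Γ(f(A)) followed by index(A) - 1.
Gamma : ℕ → DMat → List ℕ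
Gamma zero          M = []
Gamma (suc zero)    M = 0 ∷ []
Gamma (suc (suc n)) M = Gamma (suc n) (removal M) ++ [ index0 M ]

plateaus : List ℕ → ℕ
plateaus (a ∷ b ∷ xs) = (if a ≡ᵇ b then 1 else 0) + plateaus (b ∷ xs)
plateaus _ = 0

excess : DMat → ℕ
excess (d , A) = sumFin (λ i → sumFin (λ j → A i j ∸ 1))

-- Γ(A) is Γ(f(A)) followed by index(A) − 1, so it suffices to show that one removal step lowers
-- the excess Σ max(0, A_ij − 1) by one exactly when index(f(A)) = index(A), and keeps it otherwise.
-- In Rem1 with val(A) > 1 an entry ≥ 2 is lowered and stays the first positive entry of the last
-- column. In every other case the entry touched is a 1, so the excess is unchanged, and the index
-- moves: in Rem1 with val(A) = 1 that entry becomes 0; in Rem2 the dimension drops to index(A) − 1;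
-- in Rem3 the new last column is column index(A) above the diagonal, which has a positive entry
-- because row index(A) has none besides val(A).
module Submission where

open import Defs
open import Data.Nat using (ℕ; zero; suc; _+_; _∸_; _≤_; _<_; _≥_; z≤n; s≤s; s≤s⁻¹; z<s; _≡ᵇ_; _<ᵇ_)
open import Data.Nat.Properties hiding (_≟_)
open import Algebra.Properties.CommutativeSemigroup +-commutativeSemigroup using (x∙yz≈y∙xz)
open import Data.Fin using (Fin; zero; suc; toℕ; fromℕ; inject₁; punchIn; punchOut; lower₁; _≟_)
open import Data.Fin.Properties
  using (toℕ-injective; toℕ<n; toℕ≤pred[n]; toℕ-fromℕ; toℕ-inject₁; fromℕ≢inject₁; inject₁-lower₁;
         punchInᵢ≢i; punchIn-punchOut; punchIn-mono-≤; punchIn-injective)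
open import Data.Product using (∃; ∃₂; _,_; _×_; proj₁; proj₂)
open import Data.Maybe using (just; nothing)
open import Data.List using (List; []; _∷_; _++_; [_])
open import Data.Bool using (true; false; if_then_else_; T)
open import Data.Empty using (⊥-elim)
open import Function using (_∘_)
open import Relation.Nullary using (Dec; yes; no; ¬_)
open import Relation.Binary.PropositionalEquality
  using (_≡_; _≢_; refl; sym; trans; cong; cong₂; subst; subst₂; module ≡-Reasoning)
open import Relation.Binary.Definitions using (tri<; tri≈; tri>)

open ≡-Reasoning

δ : ℕ → ℕ → ℕ
δ a b = if a ≡ᵇ b then 1 else 0

δ-refl : ∀ a → δ a a ≡ 1
δ-refl zero    = refl
δ-refl (suc a) = δ-refl a

δ-≢ : ∀ {a b} → a ≢ b → δ a b ≡ 0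
δ-≢ {a} {b} a≢b with a ≡ᵇ b in a≡ᵇb
... | false = refl
... | true  = ⊥-elim (a≢b (≡ᵇ⇒≡ a b (subst T (sym a≡ᵇb) _)))

sumFin-cong : ∀ {d} {f g : Fin d → ℕ} → (∀ i → f i ≡ g i) → sumFin f ≡ sumFin g
sumFin-cong {zero}  f≗g = refl
sumFin-cong {suc d} f≗g = cong₂ _+_ (f≗g zero) (sumFin-cong (f≗g ∘ suc))

sumFin-zero : ∀ {d} {f : Fin d → ℕ} → (∀ i → f i ≡ 0) → sumFin f ≡ 0
sumFin-zero {zero}  f≗0 = refl
sumFin-zero {suc d} f≗0 = cong₂ _+_ (f≗0 zero) (sumFin-zero (f≗0 ∘ suc))

≤-sumFin : ∀ {d} (f : Fin d → ℕ) i → f i ≤ sumFin f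
≤-sumFin f zero    = m≤m+n _ _
≤-sumFin f (suc i) = ≤-trans (≤-sumFin (f ∘ suc) i) (m≤n+m _ _)

sumFin≡0⇒ : ∀ {d} (f : Fin d → ℕ) → sumFin f ≡ 0 → ∀ i → f i ≡ 0
sumFin≡0⇒ f Σ≡0 i = n≤0⇒n≡0 (subst (f i ≤_) Σ≡0 (≤-sumFin f i))

sumFin>0⇒ : ∀ {d} (f : Fin d → ℕ) → 0 < sumFin f → ∃ λ i → 0 < f i
sumFin>0⇒ {suc d} f Σ>0 with f zero in f0
... | suc _ = zero , subst (0 <_) (sym f0) z<s
... | zero with sumFin>0⇒ (f ∘ suc) Σ>0
...   | i , fi>0 = suc i , fi>0

size≤sumFin : ∀ {d} (f : Fin d → ℕ) → (∀ i → 0 < f i) → d ≤ sumFin f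
size≤sumFin {zero}  f f>0 = z≤n
size≤sumFin {suc d} f f>0 = +-mono-≤ (f>0 zero) (size≤sumFin (f ∘ suc) (f>0 ∘ suc))

sumFin-punchIn : ∀ {m} (g : Fin (suc m) → ℕ) k → sumFin g ≡ g k + sumFin (g ∘ punchIn k)
sumFin-punchIn g zero = refl
sumFin-punchIn {suc m} g (suc k) =
  trans (cong (g zero +_) (sumFin-punchIn (g ∘ suc) k))
        (x∙yz≈y∙xz (g zero) (g (suc k)) (sumFin (g ∘ suc ∘ punchIn k)))

sumFin-fromℕ : ∀ {m} (g : Fin (suc m) → ℕ) → sumFin g ≡ g (fromℕ m) + sumFin (g ∘ inject₁)
sumFin-fromℕ {zero}  g = refl
sumFin-fromℕ {suc m} g =
  trans (cong (g zero +_) (sumFin-fromℕ (g ∘ suc)))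
        (x∙yz≈y∙xz (g zero) (g (suc (fromℕ m))) (sumFin (g ∘ suc ∘ inject₁)))

sumFin-update : ∀ {d} (f g : Fin d → ℕ) k c → f k ≡ c + g k → (∀ i → i ≢ k → f i ≡ g i) →
                sumFin f ≡ c + sumFin g
sumFin-update {suc m} f g k c fk f≗g = begin
  sumFin f                            ≡⟨ sumFin-punchIn f k ⟩
  f k + sumFin (f ∘ punchIn k)        ≡⟨ cong₂ _+_ fk (sumFin-cong (λ j → f≗g (punchIn k j) (punchInᵢ≢i k j))) ⟩
  (c + g k) + sumFin (g ∘ punchIn k)  ≡⟨ +-assoc c _ _ ⟩
  c + (g k + sumFin (g ∘ punchIn k))  ≡⟨ cong (c +_) (sym (sumFin-punchIn g k)) ⟩
  c + sumFin g                        ∎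

rowSumBy : ∀ {d} → (ℕ → ℕ) → Mat d → Fin d → ℕ
rowSumBy φ A i = sumFin (λ j → φ (A i j))

-- entrySum and excess are entrySumBy for φ x = x and φ x = x ∸ 1 respectively.
entrySumBy : ∀ {d} → (ℕ → ℕ) → Mat d → ℕ
entrySumBy φ A = sumFin (rowSumBy φ A)

≤-entrySum : ∀ {d} (A : Mat d) i j → A i j ≤ entrySum A
≤-entrySum A i j = ≤-trans (≤-sumFin (A i) j) (≤-sumFin (λ i → sumFin (A i)) i)

entrySumBy-update : ∀ {d} φ (F G : Mat d) k l c → φ (F k l) ≡ c + φ (G k l) →
                    (∀ i j → ¬ (i ≡ k × j ≡ l) → F i j ≡ G i j) →
                    entrySumBy φ F ≡ c + entrySumBy φ G
entrySumBy-update φ F G k l c Fkl F≗G =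
  sumFin-update _ _ k c (sumFin-update _ _ l c Fkl (λ j j≢l → cong φ (F≗G k j (j≢l ∘ proj₂))))
                (λ i i≢k → sumFin-cong (λ j → cong φ (F≗G i j (i≢k ∘ proj₁))))

entrySumBy-fromℕ : ∀ {m} φ (A : Mat (suc m)) → φ 0 ≡ 0 →
                   (∀ i → A (inject₁ i) (fromℕ m) ≡ 0) → (∀ j → A (fromℕ m) (inject₁ j) ≡ 0) →
                   entrySumBy φ A ≡
                   φ (A (fromℕ m) (fromℕ m)) + entrySumBy φ (λ i j → A (inject₁ i) (inject₁ j))
entrySumBy-fromℕ {m} φ A φ0 lastCol lastRow =
  trans (sumFin-fromℕ (rowSumBy φ A)) (cong₂ _+_ lastRowSum (sumFin-cong initRowSum))
  where
  L = fromℕ m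
  lastRowSum : rowSumBy φ A L ≡ φ (A L L)
  lastRowSum = trans (sumFin-fromℕ (λ j → φ (A L j)))
    (trans (cong (φ (A L L) +_) (sumFin-zero (λ j → trans (cong φ (lastRow j)) φ0)))
           (+-identityʳ (φ (A L L))))
  initRowSum : ∀ i → rowSumBy φ A (inject₁ i) ≡ rowSumBy φ (λ i j → A (inject₁ i) (inject₁ j)) i
  initRowSum i = trans (sumFin-fromℕ (λ j → φ (A (inject₁ i) j)))
    (cong (_+ rowSumBy φ (λ i j → A (inject₁ i) (inject₁ j)) i) (trans (cong φ (lastCol i)) φ0))

findFirst-just : ∀ {d} (g : Fin d → ℕ) {k} → findFirst g ≡ just k →
                 0 < g k × (∀ i → toℕ i < toℕ k → g i ≡ 0)
findFirst-just {suc d} g eq with g zero in g0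
findFirst-just {suc d} g refl | suc _ = subst (0 <_) (sym g0) z<s , λ _ ()
... | zero with findFirst (g ∘ suc) in eq′
findFirst-just {suc d} g refl | zero | just k with findFirst-just (g ∘ suc) eq′
... | gk>0 , before = gk>0 , λ { zero _ → g0 ; (suc i) i<k → before i (s≤s⁻¹ i<k) }

findFirst-nothing : ∀ {d} (g : Fin d → ℕ) → findFirst g ≡ nothing → ∀ i → g i ≡ 0
findFirst-nothing {suc d} g eq i with g zero in g0
findFirst-nothing {suc d} g () i | suc _
... | zero with findFirst (g ∘ suc) in eq′
findFirst-nothing {suc d} g () i       | zero | just _
findFirst-nothing {suc d} g refl zero    | zero | nothing = g0
findFirst-nothing {suc d} g refl (suc i) | zero | nothing = findFirst-nothing (g ∘ suc) eq′ i

findFirst-unique : ∀ {d} (g : Fin d → ℕ) k → 0 < g k → (∀ i → toℕ i < toℕ k → g i ≡ 0) →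
                   findFirst g ≡ just k
findFirst-unique g k gk>0 before with findFirst g in eq
... | nothing = ⊥-elim (<⇒≢ gk>0 (sym (findFirst-nothing g eq k)))
... | just k′ with findFirst-just g eq
...   | gk′>0 , before′ with <-cmp (toℕ k) (toℕ k′)
...     | tri< k<k′ _ _ = ⊥-elim (<⇒≢ gk>0 (sym (before′ k k<k′)))
...     | tri≈ _ k≡k′ _ = cong just (toℕ-injective (sym k≡k′))
...     | tri> _ _ k′<k = ⊥-elim (<⇒≢ gk′>0 (sym (before k′ k′<k)))

≢fromℕ⇒inject₁ : ∀ {m} (j : Fin (suc m)) → j ≢ fromℕ m → ∃ λ j′ → inject₁ j′ ≡ j
≢fromℕ⇒inject₁ {m} j j≢L = lower₁ j m≢j , inject₁-lower₁ j m≢j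
  where
  m≢j : m ≢ toℕ j
  m≢j m≡j = j≢L (toℕ-injective (trans (sym m≡j) (sym (toℕ-fromℕ m))))

toℕ-inject₁<toℕ-fromℕ : ∀ {m} (i : Fin m) → toℕ (inject₁ i) < toℕ (fromℕ m)
toℕ-inject₁<toℕ-fromℕ {m} i = subst₂ _<_ (sym (toℕ-inject₁ i)) (sym (toℕ-fromℕ m)) (toℕ<n i)

punchIn-fromℕ : ∀ {m} (k : Fin (suc (suc m))) → k ≢ fromℕ (suc m) → punchIn k (fromℕ m) ≡ fromℕ (suc m)
punchIn-fromℕ zero            k≢L = refl
punchIn-fromℕ {zero} (suc zero) k≢L = ⊥-elim (k≢L refl)
punchIn-fromℕ {suc m} (suc k)   k≢L = cong suc (punchIn-fromℕ k (k≢L ∘ cong suc))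

toℕ≤toℕ-punchIn : ∀ {m} (k : Fin (suc m)) (x : Fin m) → toℕ x ≤ toℕ (punchIn k x)
toℕ≤toℕ-punchIn zero    x       = n≤1+n _
toℕ≤toℕ-punchIn (suc k) zero    = z≤n
toℕ≤toℕ-punchIn (suc k) (suc x) = s≤s (toℕ≤toℕ-punchIn k x)

punchIn-mono-< : ∀ {m} (k : Fin (suc m)) (x y : Fin m) → toℕ x < toℕ y → toℕ (punchIn k x) < toℕ (punchIn k y)
punchIn-mono-< k x y x<y = ≤∧≢⇒< (punchIn-mono-≤ k x y (<⇒≤ x<y))
  (λ eq → <⇒≢ x<y (cong toℕ (punchIn-injective k x y (toℕ-injective eq))))

index0-spec : ∀ {m} (B : Mat (suc m)) → (∃ λ i → 0 < B i (fromℕ m)) →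
              ∃ λ k → index0 (suc m , B) ≡ toℕ k × 0 < B k (fromℕ m) ×
                      (∀ i → toℕ i < toℕ k → B i (fromℕ m) ≡ 0)
index0-spec {m} B (i , Bi>0) with findFirst (λ i → B i (fromℕ m)) in eq
... | nothing = ⊥-elim (<⇒≢ Bi>0 (sym (findFirst-nothing (λ i → B i (fromℕ m)) eq i)))
... | just k  = k , refl , findFirst-just _ eq

index0-≡ : ∀ {m} (B : Mat (suc m)) k → 0 < B k (fromℕ m) → (∀ i → toℕ i < toℕ k → B i (fromℕ m) ≡ 0) →
           index0 (suc m , B) ≡ toℕ k
index0-≡ {m} B k Bk>0 before with findFirst (λ i → B i (fromℕ m)) | findFirst-unique _ k Bk>0 before
... | .(just k) | refl = refl

index0-≤ : ∀ {m} (B : Mat (suc m)) i → 0 < B i (fromℕ m) → index0 (suc m , B) ≤ toℕ i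
index0-≤ B i Bi>0 with index0-spec B (i , Bi>0)
... | k , index≡k , _ , before with <-cmp (toℕ k) (toℕ i)
...   | tri< k<i _ _ = subst (_≤ toℕ i) (sym index≡k) (<⇒≤ k<i)
...   | tri≈ _ k≡i _ = ≤-reflexive (trans index≡k k≡i)
...   | tri> _ _ i<k = ⊥-elim (<⇒≢ Bi>0 (sym (before i i<k)))

dim≤size : ∀ {n d} {A : Mat d} → IsInt n (d , A) → d ≤ n
dim≤size {d = d} {A} h = subst (d ≤_) total (size≤sumFin _ rowSum>0)
  where
  open IsInt h
  rowSum>0 : ∀ i → 0 < sumFin (A i)
  rowSum>0 i = let (j , Aij>0) = rowNZ i in ≤-trans Aij>0 (≤-sumFin (A i) j)

index0<dim : ∀ {n d} {A : Mat d} → IsInt (suc n) (d , A) → index0 (d , A) < d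
index0<dim {d = zero} h = ⊥-elim (0≢1+n (IsInt.total h))
index0<dim {d = suc m} {A} h with findFirst (λ i → A i (fromℕ m))
... | just k  = toℕ<n k
... | nothing = z<s

index0-Int1 : ∀ {B} → IsInt 1 B → index0 B ≡ 0
index0-Int1 h = n<1⇒n≡0 (≤-trans (index0<dim h) (dim≤size h))

excess-Int1 : ∀ {B} → IsInt 1 B → excess B ≡ 0
excess-Int1 {d , A} h =
  sumFin-zero (λ i → sumFin-zero (λ j → m≤n⇒m∸n≡0 (subst (A i j ≤_) (IsInt.total h) (≤-entrySum A i j))))

module _ {n m} {A : Mat (suc m)} (h : IsInt n (suc m , A)) where
  open IsInt h

  lastRow-≢ : ∀ j → j ≢ fromℕ m → A (fromℕ m) j ≡ 0
  lastRow-≢ j j≢L with ≢fromℕ⇒inject₁ j j≢L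
  ... | j′ , refl = upper (fromℕ m) (inject₁ j′) (toℕ-inject₁<toℕ-fromℕ j′)

  lastDiagonal>0 : 0 < A (fromℕ m) (fromℕ m)
  lastDiagonal>0 with rowNZ (fromℕ m)
  ... | j , ALj>0 with j ≟ fromℕ m
  ...   | yes refl = ALj>0
  ...   | no j≢L   = ⊥-elim (<⇒≢ ALj>0 (sym (lastRow-≢ j j≢L)))

decAt-≡ : ∀ {d} (A : Mat d) k l → decAt A k l k l ≡ A k l ∸ 1
decAt-≡ A k l with k ≟ k | l ≟ l
... | yes _ | yes _  = refl
... | no k≢k | _     = ⊥-elim (k≢k refl)
... | yes _ | no l≢l = ⊥-elim (l≢l refl)

decAt-≢ : ∀ {d} (A : Mat d) k l i j → ¬ (i ≡ k × j ≡ l) → decAt A k l i j ≡ A i j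
decAt-≢ A k l i j ≢kl with i ≟ k | j ≟ l
... | yes i≡k | yes j≡l = ⊥-elim (≢kl (i≡k , j≡l))
... | yes _   | no _    = refl
... | no _    | _       = refl

decAt-≤ : ∀ {d} (A : Mat d) k l i j → decAt A k l i j ≤ A i j
decAt-≤ A k l i j with i ≟ k | j ≟ l
... | yes _ | yes _ = m∸n≤m _ 1
... | yes _ | no _  = ≤-refl
... | no _  | _     = ≤-refl

entrySumBy-decAt : ∀ {d} φ (A : Mat d) k l {v} c → A k l ≡ suc v → φ (suc v) ≡ c + φ v →
                   entrySumBy φ A ≡ c + entrySumBy φ (decAt A k l)
entrySumBy-decAt φ A k l c Akl φv =
  entrySumBy-update φ A (decAt A k l) k l c Dkl (λ i j ≢kl → sym (decAt-≢ A k l i j ≢kl))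
  where
  Dkl : φ (A k l) ≡ c + φ (decAt A k l k l)
  Dkl rewrite decAt-≡ A k l | Akl = φv

IsInt-decAt : ∀ {n d} {A : Mat d} {k l v} → IsInt (suc n) (d , A) → A k l ≡ suc v →
              (∃ λ j → 0 < decAt A k l k j) → (∃ λ i → 0 < decAt A k l i l) → IsInt n (d , decAt A k l)
IsInt-decAt {A = A} {k} {l} h Akl rowk coll = record
  { upper = λ i j j<i → n≤0⇒n≡0 (≤-trans (decAt-≤ A k l i j) (≤-reflexive (upper i j j<i)))
  ; total = suc-injective (trans (sym (entrySumBy-decAt (λ x → x) A k l 1 Akl refl)) total)
  ; rowNZ = λ i → row i (i ≟ k)
  ; colNZ = λ j → col j (j ≟ l)
  }
  where
  open IsInt h
  row : ∀ i → Dec (i ≡ k) → ∃ λ j → 0 < decAt A k l i j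
  row i (yes refl) = rowk
  row i (no i≢k)   = let (j , Aij>0) = rowNZ i in j , subst (0 <_) (sym (decAt-≢ A k l i j (i≢k ∘ proj₁))) Aij>0
  col : ∀ j → Dec (j ≡ l) → ∃ λ i → 0 < decAt A k l i j
  col j (yes refl) = coll
  col j (no j≢l)   = let (i , Aij>0) = colNZ j in i , subst (0 <_) (sym (decAt-≢ A k l i j (j≢l ∘ proj₂))) Aij>0

-- i stands for index0 A, which the case analysis of removal-step turns into toℕ k.
Step : ℕ → DMat → ℕ → DMat → Set
Step n A i B = IsInt n B × excess A ≡ δ (index0 B) i + excess B

module Rem1 {n m} (A : Mat (suc m)) (h : IsInt (suc (suc n)) (suc m , A)) (k : Fin (suc m)) where
  private
    L = fromℕ m
    D = decAt A k L

  val>1 : ∀ {v} → A k L ≡ suc (suc v) → (∀ i → toℕ i < toℕ k → A i L ≡ 0) →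
          Step (suc n) (suc m , A) (toℕ k) (suc m , D)
  val>1 AkL before = IsInt-decAt h AkL (L , DkL>0) (k , DkL>0) , excess-step
    where
    DkL>0 : 0 < D k L
    DkL>0 = subst (0 <_) (sym (trans (decAt-≡ A k L) (cong (_∸ 1) AkL))) z<s
    index-kept : index0 (suc m , D) ≡ toℕ k
    index-kept = index0-≡ D k DkL>0
      (λ i i<k → trans (decAt-≢ A k L i L (λ (i≡k , _) → <⇒≢ i<k (cong toℕ i≡k))) (before i i<k))
    excess-step : excess (suc m , A) ≡ δ (index0 (suc m , D)) (toℕ k) + excess (suc m , D)
    excess-step = trans (entrySumBy-decAt (_∸ 1) A k L 1 AkL refl)
      (cong (_+ excess (suc m , D)) (sym (trans (cong (λ x → δ x (toℕ k)) index-kept) (δ-refl (toℕ k)))))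

  val≡1 : A k L ≡ 1 → k ≢ L → 0 < sumFin (λ j → A k (inject₁ j)) → Step (suc n) (suc m , A) (toℕ k) (suc m , D)
  val≡1 AkL k≢L restk>0 = IsInt-decAt h AkL rowk (L , DLL>0) , excess-step
    where
    rowk : ∃ λ j → 0 < D k j
    rowk = let (j , Akj>0) = sumFin>0⇒ _ restk>0
               Dkj≡Akj = decAt-≢ A k L k (inject₁ j) (fromℕ≢inject₁ ∘ sym ∘ proj₂)
           in inject₁ j , subst (0 <_) (sym Dkj≡Akj) Akj>0
    DLL>0 : 0 < D L L
    DLL>0 = subst (0 <_) (sym (decAt-≢ A k L L L (k≢L ∘ sym ∘ proj₁))) (lastDiagonal>0 h)
    index-moved : index0 (suc m , D) ≢ toℕ k
    index-moved index≡k with index0-spec D (L , DLL>0)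
    ... | k′ , index≡k′ , Dk′L>0 , _ with toℕ-injective (trans (sym index≡k′) index≡k)
    ...   | refl = <⇒≢ Dk′L>0 (sym (trans (decAt-≡ A k L) (cong (_∸ 1) AkL)))
    excess-step : excess (suc m , A) ≡ δ (index0 (suc m , D)) (toℕ k) + excess (suc m , D)
    excess-step = trans (entrySumBy-decAt (_∸ 1) A k L 0 AkL refl)
                    (cong (_+ excess (suc m , D)) (sym (δ-≢ index-moved)))

module Rem2 {n m} (A : Mat (suc m)) (h : IsInt (suc (suc n)) (suc m , A)) where
  open IsInt h
  private
    L = fromℕ m
    B : Mat m
    B i j = A (inject₁ i) (inject₁ j)

  step : A L L ≡ 1 → (∀ i → toℕ i < toℕ L → A i L ≡ 0) → Step (suc n) (suc m , A) (toℕ L) (m , B)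
  step ALL before = intB , excess-step
    where
    lastCol : ∀ i → A (inject₁ i) L ≡ 0
    lastCol i = before (inject₁ i) (toℕ-inject₁<toℕ-fromℕ i)
    lastRow : ∀ j → A L (inject₁ j) ≡ 0
    lastRow j = lastRow-≢ h (inject₁ j) (fromℕ≢inject₁ ∘ sym)
    sums : ∀ φ → φ 0 ≡ 0 → entrySumBy φ A ≡ φ (A L L) + entrySumBy φ B
    sums φ φ0 = entrySumBy-fromℕ φ A φ0 lastCol lastRow
    row : ∀ i → ∃ λ j → 0 < B i j
    row i with rowNZ (inject₁ i)
    ... | c , Aic>0 with c ≟ L
    ...   | yes refl = ⊥-elim (<⇒≢ Aic>0 (sym (lastCol i)))
    ...   | no c≢L with ≢fromℕ⇒inject₁ c c≢L
    ...     | j , refl = j , Aic>0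
    col : ∀ j → ∃ λ i → 0 < B i j
    col j with colNZ (inject₁ j)
    ... | r , Arj>0 with r ≟ L
    ...   | yes refl = ⊥-elim (<⇒≢ Arj>0 (sym (lastRow j)))
    ...   | no r≢L with ≢fromℕ⇒inject₁ r r≢L
    ...     | i , refl = i , Arj>0
    intB : IsInt (suc n) (m , B)
    intB = record
      { upper = λ i j j<i → upper (inject₁ i) (inject₁ j)
                              (subst₂ _<_ (sym (toℕ-inject₁ j)) (sym (toℕ-inject₁ i)) j<i)
      ; total = suc-injective (trans (sym (trans (sums (λ x → x) refl) (cong (_+ entrySum B) ALL))) total)
      ; rowNZ = row
      ; colNZ = col
      }
    index-moved : index0 (m , B) ≢ toℕ L
    index-moved index≡L = <⇒≢ (index0<dim intB) (trans index≡L (toℕ-fromℕ m))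
    excess-step : excess (suc m , A) ≡ δ (index0 (m , B)) (toℕ L) + excess (m , B)
    excess-step = trans (sums (_∸ 1) refl)
                    (cong (_+ excess (m , B)) (trans (cong (_∸ 1) ALL) (sym (δ-≢ index-moved))))

rem3-above : ∀ {m} (A : Mat (suc m)) k i j → toℕ (punchIn k i) < toℕ k → punchIn k j ≡ fromℕ m →
             rem3 A k i j ≡ A (punchIn k i) k
rem3-above {m} A k i j above last with punchIn k j ≟ fromℕ m | toℕ (punchIn k i) <ᵇ toℕ k in lt
... | yes _   | true  = refl
... | yes _   | false = ⊥-elim (subst T lt (<⇒<ᵇ above))
... | no ≢L   | _     = ⊥-elim (≢L last)

rem3-below : ∀ {m} (A : Mat (suc m)) k i j → toℕ k < toℕ (punchIn k i) →
             rem3 A k i j ≡ A (punchIn k i) (punchIn k j)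
rem3-below {m} A k i j below with punchIn k j ≟ fromℕ m | toℕ (punchIn k i) <ᵇ toℕ k in lt
... | yes _ | true  = ⊥-elim (<⇒≯ (<ᵇ⇒< _ _ (subst T (sym lt) _)) below)
... | yes _ | false = refl
... | no _  | _     = refl

rem3-inner : ∀ {m} (A : Mat (suc m)) k i j → punchIn k j ≢ fromℕ m →
             rem3 A k i j ≡ A (punchIn k i) (punchIn k j)
rem3-inner {m} A k i j ≢L with punchIn k j ≟ fromℕ m | toℕ (punchIn k i) <ᵇ toℕ k
... | yes ≡L | _ = ⊥-elim (≢L ≡L)
... | no _   | _ = refl

module Rem3 {n m} (A : Mat (suc (suc m))) (h : IsInt (suc (suc n)) (suc (suc m) , A))
            (k : Fin (suc (suc m))) (k≢L : k ≢ fromℕ (suc m)) (AkL : A k (fromℕ (suc m)) ≡ 1)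
            (restk : sumFin (λ j → A k (inject₁ j)) ≡ 0)
            (before : ∀ i → toℕ i < toℕ k → A i (fromℕ (suc m)) ≡ 0) where
  open IsInt h
  private
    L = fromℕ (suc m)
    B = rem3 A k
    ι = punchIn k

  rowk-≢ : ∀ c → c ≢ L → A k c ≡ 0
  rowk-≢ c c≢L with ≢fromℕ⇒inject₁ c c≢L
  ... | j , refl = sumFin≡0⇒ (λ j → A k (inject₁ j)) restk j

  -- Above row k, A r k moves into the last column, where A r L = 0; below it, A r k = 0.
  rowSum-rem3 : ∀ φ → φ 0 ≡ 0 → ∀ i → rowSumBy φ B i ≡ rowSumBy φ A (ι i)
  rowSum-rem3 φ φ0 i with <-cmp (toℕ (ι i)) (toℕ k)
  ... | tri< above _ _ = begin
    rowSumBy φ B i                            ≡⟨ sumFin-update _ _ (fromℕ m) (φ (A r k)) lastEntry others ⟩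
    φ (A r k) + sumFin (λ j → φ (A r (ι j)))  ≡⟨ sym (sumFin-punchIn (λ c → φ (A r c)) k) ⟩
    rowSumBy φ A r                            ∎
    where
    r = ι i
    lastEntry : φ (B i (fromℕ m)) ≡ φ (A r k) + φ (A r (ι (fromℕ m)))
    lastEntry = begin
      φ (B i (fromℕ m))                  ≡⟨ cong φ (rem3-above A k i (fromℕ m) above (punchIn-fromℕ k k≢L)) ⟩
      φ (A r k)                          ≡⟨ sym (+-identityʳ _) ⟩
      φ (A r k) + 0                      ≡⟨ cong (φ (A r k) +_) (sym (trans (cong φ (before r above)) φ0)) ⟩
      φ (A r k) + φ (A r L)              ≡⟨ cong (λ c → φ (A r k) + φ (A r c)) (sym (punchIn-fromℕ k k≢L)) ⟩
      φ (A r k) + φ (A r (ι (fromℕ m)))  ∎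
    others : ∀ j → j ≢ fromℕ m → φ (B i j) ≡ φ (A r (ι j))
    others j j≢ = cong φ (rem3-inner A k i j
      (λ ιj≡L → j≢ (punchIn-injective k j (fromℕ m) (trans ιj≡L (sym (punchIn-fromℕ k k≢L))))))
  ... | tri≈ _ ιi≡k _ = ⊥-elim (punchInᵢ≢i k i (toℕ-injective ιi≡k))
  ... | tri> _ _ below = begin
    rowSumBy φ B i                            ≡⟨ sumFin-cong (λ j → cong φ (rem3-below A k i j below)) ⟩
    0 + sumFin (λ j → φ (A r (ι j)))          ≡⟨ cong (_+ sumFin (λ j → φ (A r (ι j)))) (sym φArk≡0) ⟩
    φ (A r k) + sumFin (λ j → φ (A r (ι j)))  ≡⟨ sym (sumFin-punchIn (λ c → φ (A r c)) k) ⟩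
    rowSumBy φ A r                            ∎
    where
    r = ι i
    φArk≡0 : φ (A r k) ≡ 0
    φArk≡0 = trans (cong φ (upper r k below)) φ0

  entrySumBy-rem3 : ∀ φ → φ 0 ≡ 0 → entrySumBy φ A ≡ φ 1 + entrySumBy φ B
  entrySumBy-rem3 φ φ0 = begin
    entrySumBy φ A                                ≡⟨ sumFin-punchIn (rowSumBy φ A) k ⟩
    rowSumBy φ A k + sumFin (rowSumBy φ A ∘ ι)    ≡⟨ cong₂ _+_ rowSumk (sym (sumFin-cong (rowSum-rem3 φ φ0))) ⟩
    φ 1 + entrySumBy φ B                          ∎
    where
    rowSumk : rowSumBy φ A k ≡ φ 1
    rowSumk = trans (sumFin-punchIn (λ c → φ (A k c)) L)
      (trans (cong₂ _+_ (cong φ AkL) (sumFin-zero (λ j → trans (cong φ (rowk-≢ _ (punchInᵢ≢i L j))) φ0)))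
             (+-identityʳ (φ 1)))

  colk-above : ∃ λ i → toℕ (ι i) < toℕ k × 0 < A (ι i) k
  colk-above with colNZ k
  ... | r , Ark>0 with <-cmp (toℕ r) (toℕ k)
  ...   | tri< r<k _ _ =
    punchOut k≢r , subst (λ x → toℕ x < toℕ k × 0 < A x k) (sym (punchIn-punchOut k≢r)) (r<k , Ark>0)
    where
    k≢r : k ≢ r
    k≢r k≡r = <⇒≢ r<k (cong toℕ (sym k≡r))
  ...   | tri≈ _ r≡k _ =
    ⊥-elim (<⇒≢ Ark>0 (sym (trans (cong (λ x → A x k) (toℕ-injective r≡k)) (rowk-≢ k k≢L))))
  ...   | tri> _ _ k<r = ⊥-elim (<⇒≢ Ark>0 (sym (upper r k k<r)))

  intB : IsInt (suc n) (suc m , B)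
  intB = record
    { upper = upperB
    ; total = suc-injective (trans (sym (entrySumBy-rem3 (λ x → x) refl)) total)
    ; rowNZ = λ i → let (c , Aιic>0) = rowNZ (ι i)
                    in sumFin>0⇒ (B i) (subst (0 <_) (sym (rowSum-rem3 (λ x → x) refl i))
                                                     (≤-trans Aιic>0 (≤-sumFin (A (ι i)) c)))
    ; colNZ = λ j → col j (ι j ≟ L)
    }
    where
    upperB : ∀ i j → toℕ j < toℕ i → B i j ≡ 0
    upperB i j j<i = trans (rem3-inner A k i j ιj≢L) (upper (ι i) (ι j) ιj<ιi)
      where
      ιj<ιi = punchIn-mono-< k j i j<i
      ιj≢L : ι j ≢ L
      ιj≢L ιj≡L = <⇒≱ (subst (_< toℕ (ι i)) (trans (cong toℕ ιj≡L) (toℕ-fromℕ _)) ιj<ιi) (toℕ≤pred[n] (ι i))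
    col : ∀ j → Dec (ι j ≡ L) → ∃ λ i → 0 < B i j
    col j (yes ιj≡L) = let (i , above , Aιik>0) = colk-above
                       in i , subst (0 <_) (sym (rem3-above A k i j above ιj≡L)) Aιik>0
    col j (no ιj≢L) with colNZ (ι j)
    ... | r , Arιj>0 = punchOut k≢r , subst (0 <_) (sym Bij) Arιj>0
      where
      k≢r : k ≢ r
      k≢r refl = <⇒≢ Arιj>0 (sym (rowk-≢ (ι j) ιj≢L))
      Bij : B (punchOut k≢r) j ≡ A r (ι j)
      Bij = trans (rem3-inner A k _ j ιj≢L) (cong (λ x → A x (ι j)) (punchIn-punchOut k≢r))

  index<k : index0 (suc m , B) < toℕ k
  index<k = let (i , above , Aιik>0) = colk-above
                Bi>0 = subst (0 <_) (sym (rem3-above A k i (fromℕ m) above (punchIn-fromℕ k k≢L))) Aιik>0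
            in ≤-<-trans (index0-≤ B i Bi>0) (≤-<-trans (toℕ≤toℕ-punchIn k i) above)

  step : Step (suc n) (suc (suc m) , A) (toℕ k) (suc m , B)
  step = intB , trans (entrySumBy-rem3 (_∸ 1) refl) (cong (_+ excess (suc m , B)) (sym (δ-≢ (<⇒≢ index<k))))

rem3-step : ∀ {n m} (A : Mat (suc m)) → IsInt (suc (suc n)) (suc m , A) → ∀ k → k ≢ fromℕ m →
            A k (fromℕ m) ≡ 1 → sumFin (λ j → A k (inject₁ j)) ≡ 0 → (∀ i → toℕ i < toℕ k → A i (fromℕ m) ≡ 0) →
            Step (suc n) (suc m , A) (toℕ k) (m , rem3 A k)
rem3-step {m = zero}  A h zero k≢L = ⊥-elim (k≢L refl)
rem3-step {m = suc m} A h k k≢L    = Rem3.step A h k k≢L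

removal-step : ∀ {n} A → IsInt (suc (suc n)) A → Step (suc n) A (index0 A) (removal A)
removal-step (zero , A) h = ⊥-elim (0≢1+n (IsInt.total h))
removal-step (suc m , A) h with findFirst (λ i → A i (fromℕ m)) in first
... | nothing = let (r , ArL>0) = IsInt.colNZ h (fromℕ m)
                in ⊥-elim (<⇒≢ ArL>0 (sym (findFirst-nothing (λ i → A i (fromℕ m)) first r)))
... | just k with findFirst-just (λ i → A i (fromℕ m)) first
...   | AkL>0 , before with A k (fromℕ m) in AkL
...     | zero        = ⊥-elim (<-irrefl refl AkL>0)
...     | suc (suc _) = Rem1.val>1 A h k AkL before
...     | suc zero with k ≟ fromℕ m
...       | yes refl = Rem2.step A h AkL before
...       | no k≢L with sumFin (λ j → A k (inject₁ j)) in restk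
...         | suc _ = Rem1.val≡1 A h k AkL k≢L (subst (0 <_) (sym restk) z<s)
...         | zero  = rem3-step A h k k≢L AkL restk before

lastOf : ℕ → List ℕ → ℕ
lastOf x []       = x
lastOf _ (y ∷ ys) = lastOf y ys

lastOf-∷ʳ : ∀ x xs a → lastOf x (xs ++ [ a ]) ≡ a
lastOf-∷ʳ x []       a = refl
lastOf-∷ʳ x (y ∷ ys) a = lastOf-∷ʳ y ys a

plateaus-∷ʳ : ∀ x xs a → plateaus ((x ∷ xs) ++ [ a ]) ≡ δ (lastOf x xs) a + plateaus (x ∷ xs)
plateaus-∷ʳ x []       a = refl
plateaus-∷ʳ x (y ∷ ys) a =
  trans (cong (δ x y +_) (plateaus-∷ʳ y ys a)) (x∙yz≈y∙xz (δ x y) (δ (lastOf y ys) a) (plateaus (y ∷ ys)))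

Gamma-∷ : ∀ n B → IsInt (suc n) B → ∃₂ λ x xs → Gamma (suc n) B ≡ x ∷ xs × lastOf x xs ≡ index0 B
Gamma-∷ zero    B h = 0 , [] , refl , sym (index0-Int1 h)
Gamma-∷ (suc n) B h with Gamma-∷ n (removal B) (proj₁ (removal-step B h))
... | x , xs , Γ≡ , _ = x , xs ++ [ index0 B ] , cong (_++ [ index0 B ]) Γ≡ , lastOf-∷ʳ x xs _

excess≡plateaus : ∀ n A → IsInt (suc n) A → excess A ≡ plateaus (Gamma (suc n) A)
excess≡plateaus zero    A h = excess-Int1 h
excess≡plateaus (suc n) A h with removal-step A h
... | h′ , excess-step with Gamma-∷ n (removal A) h′
...   | x , xs , Γ≡ , last≡ = begin
  excess A                                                ≡⟨ excess-step ⟩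
  δ (index0 (removal A)) (index0 A) + excess (removal A)  ≡⟨ cong₂ (λ u v → δ u (index0 A) + v) (sym last≡)
                                                               (trans (excess≡plateaus n _ h′) (cong plateaus Γ≡)) ⟩
  δ (lastOf x xs) (index0 A) + plateaus (x ∷ xs)          ≡⟨ sym (plateaus-∷ʳ x xs _) ⟩
  plateaus ((x ∷ xs) ++ [ index0 A ])                     ≡⟨ cong (λ ys → plateaus (ys ++ [ index0 A ])) (sym Γ≡) ⟩
  plateaus (Gamma (suc (suc n)) A)                        ∎

mainTheorem11 : ∀ (n : ℕ) → n ≥ 1 → ∀ (A : DMat) → IsInt n A → excess A ≡ plateaus (Gamma n A)
mainTheorem11 (suc n) _ A h = excess≡plateaus n A h
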